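{- For every odd integer $n\ge 3$ there exists a divisible design Cayley digraph with parameters $(4n,\ n+2,\ n-2,\ 2,\ 4,\ n)$.
   Context: A digraph $D=(V,E)$ has a finite nonempty vertex set $V$ and arc set $E\subseteq\{(x,y):x,y\in V,\ x\neq y\}$; $x$ dominates $y$ if $(x,y)\in E$. $D$ is asymmetric if $(x,y)\in E$ implies $(y,x)\notin E$, and regular of degree $k$ if every vertex dominates exactly $k$ vertices and is dominated by exactly $k$ vertices. A divisible design digraph (DDD) with parameters $(v,k,\lambda_1,\lambda_2,m,n)$ is a regular asymmetric digraph of degree $k$ on $v$ vertices whose vertex set can be partitioned into $m$ classes of size $n$ such that for any two distinct vertices $x,y$ in the same class, the number of vertices dominating both and the number of vertices dominated by both are each $\lambda_1$, and for distinct vertices in different classes these numbers are each $\lambda_2$. For a finite group $G$ with identity $e$ and $S\subseteq G\setminus\{e\}$, the Cayley digraph ${\rm Cay}(G,S)$ has vertex set $G$ and arcs $(g,gs)$, $g\in G$, $s\in S$. A divisible design Cayley digraph with given parameters is a Cayley digraph which is a DDD with those parameters. -}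

module Defs where

open import Data.Nat using (ℕ; zero; suc; _+_; _*_)
open import Data.Bool using (Bool; true; false; _∧_; if_then_else_)
open import Data.Fin using (Fin; zero; suc; _≟_)
open import Data.Product using (Σ; _×_; _,_; proj₁)
open import Relation.Nullary using (¬_)
open import Relation.Nullary.Decidable using (⌊_⌋)
open import Relation.Binary.PropositionalEquality using (_≡_; trans; cong)
open import Algebra.Structures using (IsGroup)

count : ∀ {v} → (Fin v → Bool) → ℕ
count {zero}  P = 0
count {suc v} P = (if P zero then 1 else 0) + count (λ i → P (suc i))

-- A finite digraph on vertex set Fin v; arcs given by a Boolean relation.
-- E x y ≡ true means x dominates y.  No loops.
record Digraph (v : ℕ) : Set where
  field
    E     : Fin v → Fin v → Bool
    loopless : ∀ x → E x x ≡ false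

module _ {v : ℕ} (D : Digraph v) where
  open Digraph D

  IsAsymmetric : Set
  IsAsymmetric = ∀ x y → E x y ≡ true → E y x ≡ false

  outdeg indeg : Fin v → ℕ
  outdeg x = count (λ y → E x y)
  indeg  x = count (λ y → E y x)

  IsRegular : ℕ → Set
  IsRegular k = ∀ x → outdeg x ≡ k × indeg x ≡ k

  commonIn : Fin v → Fin v → ℕ
  commonIn x y = count (λ z → E z x ∧ E z y)

  commonOut : Fin v → Fin v → ℕ
  commonOut x y = count (λ z → E x z ∧ E y z)

  IsPartition : (m n : ℕ) → (Fin v → Fin m) → Set
  IsPartition m n cls = ∀ (i : Fin m) → count (λ x → ⌊ cls x ≟ i ⌋) ≡ n

  -- Divisible design digraph with parameters (v,k,λ₁,λ₂,m,n)
  -- (v is the number of vertices, i.e. the index of the digraph type).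
  IsDDD : (k λ₁ λ₂ m n : ℕ) → Set
  IsDDD k λ₁ λ₂ m n =
    IsRegular k × IsAsymmetric ×
    Σ (Fin v → Fin m) λ cls →
      IsPartition m n cls ×
      (∀ x y → ¬ (x ≡ y) → cls x ≡ cls y →
          commonIn x y ≡ λ₁ × commonOut x y ≡ λ₁) ×
      (∀ x y → ¬ (x ≡ y) → ¬ (cls x ≡ cls y) →
          commonIn x y ≡ λ₂ × commonOut x y ≡ λ₂)

-- A finite group whose underlying set is Fin v (every finite group of
-- order v is isomorphic to one of these).
record FinGroup (v : ℕ) : Set where
  field
    _∙_   : Fin v → Fin v → Fin v
    e     : Fin v
    _⁻¹   : Fin v → Fin v
    isGroup : IsGroup _≡_ _∙_ e _⁻¹

Cay : ∀ {v} (G : FinGroup v) (S : Fin v → Bool) →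
      S (FinGroup.e G) ≡ false → Digraph v
Cay G S Se = record
  { E = λ g h → S ((g ⁻¹) ∙ h)
  ; loopless = λ g → trans (cong S (proj₁ (IsGroup.inverse isGroup) g)) Se }
  where open FinGroup G

ExistsDDCayley : (v k λ₁ λ₂ m n : ℕ) → Set
ExistsDDCayley v k λ₁ λ₂ m n =
  Σ (FinGroup v) λ G → Σ (Fin v → Bool) λ S → Σ (S (FinGroup.e G) ≡ false) λ Se →
    IsDDD (Cay G S Se) k λ₁ λ₂ m n

-- Take G = ℤ₄ × ℤₙ, S = {(0,1), (1,0), (2,1)} ∪ {3} × (ℤₙ ∖ {0}), and as classes the cosets of
-- {0} × ℤₙ. S has n + 2 elements and is disjoint from −S, so Cay(G,S) is regular and asymmetric.
-- In a Cayley digraph of an abelian group, the numbers of common in- and out-neighbours of x and y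
-- are the numbers of w ∈ S with w + d ∈ S for d = y − x and d = x − y respectively. Counting coset
-- by coset, this is n − 2 for 0 ≠ d ∈ {0} × ℤₙ and 2 for every d outside {0} × ℤₙ.
-- The argument works for every n ≥ 3.
module Submission where

open import Defs
open import Data.Nat using (ℕ; suc; _+_; _*_; _∸_; _≤_)
open import Data.Product using (Σ)
open import Relation.Binary.PropositionalEquality using (_≡_)

open import Algebra.Bundles using (AbelianGroup)
open import Algebra.Core using (Op₁; Op₂)
import Algebra.Construct.DirectProduct as DirectProduct
open import Algebra.Morphism.Structures using (IsGroupMonomorphism)
import Algebra.Morphism.GroupMonomorphism as GroupMonomorphism
import Algebra.Properties.AbelianGroup as AbelianGroupProperties
open import Algebra.Structures using (IsGroup; IsAbelianGroup)
open import Data.Bool using (Bool; true; false; _∧_; not; if_then_else_)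
open import Data.Bool.Properties using (∧-comm; ∧-identityʳ; not-involutive)
open import Data.Fin using (Fin; zero; suc; toℕ; combine; remQuot; quotient; _↑ˡ_; _↑ʳ_; _≟_)
open import Data.Fin.Patterns using (0F; 1F; 2F; 3F)
open import Data.Fin.Permutation using (permutation)
open import Data.Fin.Properties using (toℕ-fromℕ<; toℕ<n; toℕ-injective; remQuot-combine; combine-remQuot)
open import Data.Nat using (zero; s≤s; NonZero; _%_; >-nonZero⁻¹)
open import Data.Nat.DivMod using (_mod_; m%n<n; m<n⇒m%n≡m; %-distribˡ-+; n%n≡0)
open import Data.Nat.Properties
  using ( suc-injective; n<1+n; <⇒≤; +-suc; +-assoc; +-comm; +-identityʳ; *-zeroʳ; *-identityˡ
        ; *-distribʳ-+; m∸n+n≡m; +-0-commutativeMonoid)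
open import Data.Product using (_,_; proj₁; _×_; uncurry)
open import Data.Product.Relation.Binary.Pointwise.NonDependent using (≡⇒≡×≡; ≡×≡⇒≡)
open import Data.Vec.Functional using ([]; _∷_)
open import Function using (_∘_; _⇔_; mk⇔; Equivalence)
open import Level using (0ℓ)
open import Relation.Binary.PropositionalEquality
  using (refl; sym; trans; cong; cong₂; subst; isEquivalence; module ≡-Reasoning)
open import Relation.Nullary using (¬_; Dec; does; proof; ¬?; contradiction)
open import Relation.Nullary.Decidable using (⌊_⌋; isYes≗does; dec-true; dec-false; does-⇔)
open import Relation.Nullary.Reflects using (Reflects; invert)
open import Algebra.Properties.CommutativeMonoid.Sum +-0-commutativeMonoid
  using (sum; sum-syntax; sum-permute; sum-cong-≗)

open ≡-Reasoning

indicator : Bool → ℕ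
indicator b = if b then 1 else 0

does-true : ∀ {a} {A : Set a} (a? : Dec A) → does a? ≡ true → A
does-true a? does≡true = invert (subst (Reflects _) does≡true (proof a?))

indicator-interleaved-complements : ∀ p q →
  indicator p + (indicator q + (indicator (not p) + (indicator (not q) + 0))) ≡ 2
indicator-interleaved-complements true  true  = refl
indicator-interleaved-complements true  false = refl
indicator-interleaved-complements false true  = refl
indicator-interleaved-complements false false = refl

indicator-adjacent-complements : ∀ p →
  indicator p + (indicator (not p) + (indicator p + (indicator (not p) + 0))) ≡ 2
indicator-adjacent-complements true  = refl
indicator-adjacent-complements false = refl

-- Counting over Fin

count-cong : ∀ {v} {P Q : Fin v → Bool} → (∀ i → P i ≡ Q i) → count P ≡ count Q
count-cong {zero}  _   = refl
count-cong {suc v} P≗Q = cong₂ (λ b r → indicator b + r) (P≗Q zero) (count-cong (P≗Q ∘ suc))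

count-true : ∀ {v} → count {v} (λ _ → true) ≡ v
count-true {zero}  = refl
count-true {suc v} = cong suc count-true

count-const : ∀ {v} b → count {v} (λ _ → b) ≡ indicator b * v
count-const {zero}  b     = sym (*-zeroʳ (indicator b))
count-const {v}     true  = trans count-true (sym (*-identityˡ v))
count-const {suc v} false = count-const {v} false

count-∧-split : ∀ {v} (P Q : Fin v → Bool) →
  count (λ j → P j ∧ Q j) + count (λ j → not (P j) ∧ Q j) ≡ count Q
count-∧-split {zero}  P Q = refl
count-∧-split {suc v} P Q with P zero | Q zero | count-∧-split (P ∘ suc) (Q ∘ suc)
... | true  | true  | ih = cong suc ih
... | true  | false | ih = ih
... | false | true  | ih = trans (+-suc _ _) (cong suc ih)
... | false | false | ih = ih

count-singleton : ∀ {v} (c : Fin v) (Q : Fin v → Bool) → count (λ j → does (j ≟ c) ∧ Q j) ≡ indicator (Q c)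
count-singleton {suc v} zero    Q with Q zero
... | true  = cong suc (count-const {v} false)
... | false = count-const {v} false
count-singleton {suc v} (suc c) Q = count-singleton c (Q ∘ suc)

count-≡ : ∀ {v} (c : Fin v) → count (λ j → does (j ≟ c)) ≡ 1
count-≡ c = trans (count-cong (λ j → sym (∧-identityʳ (does (j ≟ c))))) (count-singleton c (λ _ → true))

suc-count-≢ : ∀ {v} (c : Fin v) → suc (count (λ j → not (does (j ≟ c)))) ≡ v
suc-count-≢ {v} c = begin
  1 + count (λ j → not (does (j ≟ c)))
    ≡⟨ cong₂ _+_ (count-singleton c (λ _ → true)) (count-cong (λ j → ∧-identityʳ (not (does (j ≟ c))))) ⟨
  count (λ j → does (j ≟ c) ∧ true) + count (λ j → not (does (j ≟ c)) ∧ true)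
    ≡⟨ count-∧-split (λ j → does (j ≟ c)) (λ _ → true) ⟩
  count {v} (λ _ → true)
    ≡⟨ count-true ⟩
  v ∎

count≡sum : ∀ {v} (P : Fin v → Bool) → count P ≡ sum (indicator ∘ P)
count≡sum {zero}  P = refl
count≡sum {suc v} P = cong (indicator (P zero) +_) (count≡sum (P ∘ suc))

count-∘-bijection : ∀ {v} (f g : Fin v → Fin v) → (∀ y → f (g y) ≡ y) → (∀ x → g (f x) ≡ x) →
                    (P : Fin v → Bool) → count (P ∘ f) ≡ count P
count-∘-bijection f g f∘g g∘f P = begin
  count (P ∘ f)            ≡⟨ count≡sum (P ∘ f) ⟩
  sum (indicator ∘ P ∘ f)  ≡⟨ sum-permute (indicator ∘ P) (permutation f g f∘g g∘f) ⟨
  sum (indicator ∘ P)      ≡⟨ count≡sum P ⟨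
  count P                  ∎

count-++ : ∀ a {b} (P : Fin (a + b) → Bool) → count P ≡ count (P ∘ (_↑ˡ b)) + count (P ∘ (a ↑ʳ_))
count-++ zero    P = refl
count-++ (suc a) P =
  trans (cong (indicator (P zero) +_) (count-++ a (P ∘ suc))) (sym (+-assoc (indicator (P zero)) _ _))

count-combine : ∀ {m n} (P : Fin (m * n) → Bool) → count P ≡ ∑[ i < m ] count (λ j → P (combine i j))
count-combine {zero}      P = refl
count-combine {suc m} {n} P =
  trans (count-++ n P) (cong (count (λ j → P (j ↑ˡ m * n)) +_) (count-combine {m} {n} (P ∘ (n ↑ʳ_))))

count-quotient : ∀ {m} n (P : Fin m → Bool) → count (λ x → P (quotient {m} n x)) ≡ count P * n
count-quotient {m} n P = begin
  count (λ x → P (quotient n x))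
    ≡⟨ count-combine {m} {n} (λ x → P (quotient n x)) ⟩
  ∑[ i < m ] count (λ j → P (quotient n (combine i j)))
    ≡⟨ sum-cong-≗ (λ i → count-cong {n} (λ j → cong (P ∘ proj₁) (remQuot-combine i j))) ⟩
  ∑[ i < m ] count {n} (λ _ → P i)
    ≡⟨ sum-constantRows P ⟩
  count P * n ∎
  where
  sum-constantRows : ∀ {m} (P : Fin m → Bool) → ∑[ i < m ] count {n} (λ _ → P i) ≡ count P * n
  sum-constantRows {zero}  P = refl
  sum-constantRows {suc m} P = begin
    count {n} (λ _ → P zero) + ∑[ i < m ] count {n} (λ _ → P (suc i))
      ≡⟨ cong₂ _+_ (count-const {n} (P zero)) (sum-constantRows (P ∘ suc)) ⟩
    indicator (P zero) * n + count (P ∘ suc) * n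
      ≡⟨ *-distribʳ-+ n (indicator (P zero)) _ ⟨
    count P * n ∎

-- Finite abelian groups

record FinAbelianGroup (v : ℕ) : Set where
  infixl 7 _∙_
  infix  8 _⁻¹
  field
    _∙_            : Op₂ (Fin v)
    ε              : Fin v
    _⁻¹            : Op₁ (Fin v)
    isAbelianGroup : IsAbelianGroup _≡_ _∙_ ε _⁻¹

  open IsAbelianGroup isAbelianGroup public hiding (refl; sym; trans)
  open IsGroup isGroup public using (_\\_; _//_)

  finGroup : FinGroup v
  finGroup = record { isGroup = isGroup }

  abelianGroup : AbelianGroup 0ℓ 0ℓ
  abelianGroup = record { isAbelianGroup = isAbelianGroup }

  open AbelianGroupProperties abelianGroup using (⁻¹-anti-homo-\\; ⁻¹-injective; inverseˡ-unique)

  x\\y≡ε⇔x≡y : ∀ {x y} → x \\ y ≡ ε ⇔ x ≡ y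
  x\\y≡ε⇔x≡y {x} {y} =
    mk⇔ (λ x\\y≡ε → ⁻¹-injective (inverseˡ-unique (x ⁻¹) y x\\y≡ε)) (λ { refl → inverseˡ x })

  x\\[y∙z]≡z∙[x\\y] : ∀ x y z → x \\ (y ∙ z) ≡ z ∙ (x \\ y)
  x\\[y∙z]≡z∙[x\\y] x y z = trans (sym (assoc (x ⁻¹) y z)) (comm (x \\ y) z)

  [x\\y]\\z≡x∙[y\\z] : ∀ x y z → (x \\ y) \\ z ≡ x ∙ (y \\ z)
  [x\\y]\\z≡x∙[y\\z] x y z = begin
    (x \\ y) ⁻¹ ∙ z  ≡⟨ cong (_∙ z) (⁻¹-anti-homo-\\ x y) ⟩
    y ⁻¹ ∙ x ∙ z     ≡⟨ cong (_∙ z) (comm (y ⁻¹) x) ⟩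
    x ∙ y ⁻¹ ∙ z     ≡⟨ assoc x (y ⁻¹) z ⟩
    x ∙ (y \\ z)     ∎

  [x\\y]\\y≡x : ∀ x y → (x \\ y) \\ y ≡ x
  [x\\y]\\y≡x x y = trans ([x\\y]\\z≡x∙[y\\z] x y y) (trans (cong (x ∙_) (inverseˡ y)) (identityʳ x))

module Cyclic (n : ℕ) .{{_ : NonZero n}} where

  infixl 6 _+ₙ_

  _+ₙ_ : Op₂ (Fin n)
  a +ₙ b = (toℕ a + toℕ b) mod n

  0ₙ : Fin n
  0ₙ = 0 mod n

  -ₙ_ : Op₁ (Fin n)
  -ₙ a = (n ∸ toℕ a) mod n

  toℕ-mod : ∀ k → toℕ (k mod n) ≡ k % n
  toℕ-mod k = toℕ-fromℕ< (m%n<n k n)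

  toℕ-mod-cancel : ∀ a → toℕ a mod n ≡ a
  toℕ-mod-cancel a = toℕ-injective (trans (toℕ-mod (toℕ a)) (m<n⇒m%n≡m (toℕ<n a)))

  mod-+-homo : ∀ k l → (k + l) mod n ≡ k mod n +ₙ l mod n
  mod-+-homo k l = toℕ-injective (begin
    toℕ ((k + l) mod n)                  ≡⟨ toℕ-mod (k + l) ⟩
    (k + l) % n                          ≡⟨ %-distribˡ-+ k l n ⟩
    (k % n + l % n) % n                  ≡⟨ cong₂ (λ x y → (x + y) % n) (toℕ-mod k) (toℕ-mod l) ⟨
    (toℕ (k mod n) + toℕ (l mod n)) % n  ≡⟨ toℕ-mod _ ⟨
    toℕ (k mod n +ₙ l mod n)             ∎)

  +ₙ-assoc : ∀ a b c → (a +ₙ b) +ₙ c ≡ a +ₙ (b +ₙ c)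
  +ₙ-assoc a b c = begin
    (a +ₙ b) +ₙ c                         ≡⟨ cong ((a +ₙ b) +ₙ_) (toℕ-mod-cancel c) ⟨
    (toℕ a + toℕ b) mod n +ₙ toℕ c mod n  ≡⟨ mod-+-homo (toℕ a + toℕ b) (toℕ c) ⟨
    (toℕ a + toℕ b + toℕ c) mod n         ≡⟨ cong (_mod n) (+-assoc (toℕ a) (toℕ b) (toℕ c)) ⟩
    (toℕ a + (toℕ b + toℕ c)) mod n       ≡⟨ mod-+-homo (toℕ a) (toℕ b + toℕ c) ⟩
    toℕ a mod n +ₙ (toℕ b + toℕ c) mod n  ≡⟨ cong (_+ₙ (b +ₙ c)) (toℕ-mod-cancel a) ⟩
    a +ₙ (b +ₙ c)                         ∎

  +ₙ-comm : ∀ a b → a +ₙ b ≡ b +ₙ a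
  +ₙ-comm a b = cong (_mod n) (+-comm (toℕ a) (toℕ b))

  +ₙ-identityˡ : ∀ a → 0ₙ +ₙ a ≡ a
  +ₙ-identityˡ a = begin
    0ₙ +ₙ a                 ≡⟨ cong (0ₙ +ₙ_) (toℕ-mod-cancel a) ⟨
    0 mod n +ₙ toℕ a mod n  ≡⟨ mod-+-homo 0 (toℕ a) ⟨
    toℕ a mod n             ≡⟨ toℕ-mod-cancel a ⟩
    a                       ∎

  n-mod-n≡0ₙ : n mod n ≡ 0ₙ
  n-mod-n≡0ₙ = toℕ-injective (begin
    toℕ (n mod n)  ≡⟨ toℕ-mod n ⟩
    n % n          ≡⟨ n%n≡0 n ⟩
    0              ≡⟨ m<n⇒m%n≡m (>-nonZero⁻¹ n) ⟨
    0 % n          ≡⟨ toℕ-mod 0 ⟨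
    toℕ 0ₙ         ∎)

  +ₙ-inverseˡ : ∀ a → -ₙ a +ₙ a ≡ 0ₙ
  +ₙ-inverseˡ a = begin
    -ₙ a +ₙ a                         ≡⟨ cong (-ₙ a +ₙ_) (toℕ-mod-cancel a) ⟨
    (n ∸ toℕ a) mod n +ₙ toℕ a mod n  ≡⟨ mod-+-homo (n ∸ toℕ a) (toℕ a) ⟨
    (n ∸ toℕ a + toℕ a) mod n         ≡⟨ cong (_mod n) (m∸n+n≡m (<⇒≤ (toℕ<n a))) ⟩
    n mod n                           ≡⟨ n-mod-n≡0ₙ ⟩
    0ₙ                                ∎

cyclic : (n : ℕ) .{{_ : NonZero n}} → FinAbelianGroup n
cyclic n = record
  { _∙_ = _+ₙ_ ; ε = 0ₙ ; _⁻¹ = -ₙ_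
  ; isAbelianGroup = record
    { isGroup = record
      { isMonoid = record
        { isSemigroup = record
          { isMagma = record { isEquivalence = isEquivalence ; ∙-cong = cong₂ _+ₙ_ }
          ; assoc = +ₙ-assoc }
        ; identity = +ₙ-identityˡ , λ a → trans (+ₙ-comm a 0ₙ) (+ₙ-identityˡ a) }
      ; inverse = +ₙ-inverseˡ , λ a → trans (+ₙ-comm a (-ₙ a)) (+ₙ-inverseˡ a)
      ; ⁻¹-cong = cong -ₙ_ }
    ; comm = +ₙ-comm } }
  where open Cyclic n

-- Fin (m * n) carries the product group through remQuot, whose injectivity transfers the laws.
module Product {m n} (G : FinAbelianGroup m) (H : FinAbelianGroup n) where

  private
    module G = FinAbelianGroup G
    module H = FinAbelianGroup H
    G×H = DirectProduct.abelianGroup G.abelianGroup H.abelianGroup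
    module G×H = AbelianGroup G×H

  infixl 7 _∙_

  split : Fin (m * n) → Fin m × Fin n
  split = remQuot n

  join : Fin m × Fin n → Fin (m * n)
  join = uncurry combine

  _∙_ : Op₂ (Fin (m * n))
  x ∙ y = join (split x G×H.∙ split y)

  ε : Fin (m * n)
  ε = combine G.ε H.ε

  _⁻¹ : Op₁ (Fin (m * n))
  x ⁻¹ = join (split x G×H.⁻¹)

  split-isGroupMonomorphism : IsGroupMonomorphism (record { _∙_ = _∙_ ; ε = ε ; _⁻¹ = _⁻¹ }) G×H.rawGroup split
  split-isGroupMonomorphism = record
    { isGroupHomomorphism = record
      { isMonoidHomomorphism = record
        { isMagmaHomomorphism = record
          { isRelHomomorphism = record { cong = ≡⇒≡×≡ ∘ cong split }
          ; homo = λ x y → ≡⇒≡×≡ (remQuot-combine _ _) }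
        ; ε-homo = ≡⇒≡×≡ (remQuot-combine G.ε H.ε) }
      ; ⁻¹-homo = λ x → ≡⇒≡×≡ (remQuot-combine _ _) }
    ; injective = λ {x} {y} split≈ → begin
        x               ≡⟨ combine-remQuot {m} n x ⟨
        join (split x)  ≡⟨ cong join (≡×≡⇒≡ split≈) ⟩
        join (split y)  ≡⟨ combine-remQuot {m} n y ⟩
        y               ∎ }

  combine-∙ : ∀ a i b j → combine a i ∙ combine b j ≡ combine (a G.∙ b) (i H.∙ j)
  combine-∙ a i b j = cong₂ (λ p q → join (p G×H.∙ q)) (remQuot-combine a i) (remQuot-combine b j)

  combine-⁻¹ : ∀ a i → combine a i ⁻¹ ≡ combine (a G.⁻¹) (i H.⁻¹)
  combine-⁻¹ a i = cong (λ p → join (p G×H.⁻¹)) (remQuot-combine a i)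

  quotient-∙ : ∀ x y → quotient n (x ∙ y) ≡ quotient n x G.∙ quotient n y
  quotient-∙ x y = cong proj₁ (remQuot-combine {m} _ _)

  quotient-⁻¹ : ∀ x → quotient n (x ⁻¹) ≡ quotient n x G.⁻¹
  quotient-⁻¹ x = cong proj₁ (remQuot-combine {m} _ _)

infixr 2 _×ᴳ_

_×ᴳ_ : ∀ {m n} → FinAbelianGroup m → FinAbelianGroup n → FinAbelianGroup (m * n)
G ×ᴳ H = record
  { _∙_ = _∙_ ; ε = ε ; _⁻¹ = _⁻¹
  ; isAbelianGroup = GroupMonomorphism.isAbelianGroup split-isGroupMonomorphism
                       (AbelianGroup.isAbelianGroup (DirectProduct.abelianGroup G.abelianGroup H.abelianGroup)) }
  where
  open Product G H
  module G = FinAbelianGroup G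
  module H = FinAbelianGroup H

∀-combine : ∀ {m n} {P : Fin (m * n) → Set} → (∀ a j → P (combine a j)) → ∀ x → P x
∀-combine {m} {n} {P} P-combine x = subst P (combine-remQuot {m} n x) (uncurry P-combine (remQuot {m} n x))

module GroupCounting {v} (G : FinAbelianGroup v) where

  open FinAbelianGroup G using (_∙_; ε; _\\_; _//_; identityʳ; [x\\y]\\y≡x; abelianGroup)
  open AbelianGroupProperties abelianGroup
    using ( \\-leftDividesˡ; \\-leftDividesʳ; //-rightDividesˡ; //-rightDividesʳ
          ; x∙y⁻¹≈ε⇒x≈y; x≈y⇒x∙y⁻¹≈ε; identityʳ-unique)

  count-∘-translate : ∀ x (P : Fin v → Bool) → count (λ w → P (x ∙ w)) ≡ count P
  count-∘-translate x = count-∘-bijection (x ∙_) (x \\_) (\\-leftDividesˡ x) (\\-leftDividesʳ x)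

  count-∘-\\ : ∀ x (P : Fin v → Bool) → count (λ z → P (z \\ x)) ≡ count P
  count-∘-\\ x = count-∘-bijection (_\\ x) (_\\ x) (λ z → [x\\y]\\y≡x z x) (λ z → [x\\y]\\y≡x z x)

  ∙≟-translate : ∀ j δ c → does (j ∙ δ ≟ c) ≡ does (j ≟ c // δ)
  ∙≟-translate j δ c = does-⇔ (mk⇔ (λ j∙δ≡c → trans (sym (//-rightDividesʳ δ j)) (cong (_// δ) j∙δ≡c))
                                   (λ j≡c//δ → trans (cong (_∙ δ) j≡c//δ) (//-rightDividesˡ δ c)))
                              (j ∙ δ ≟ c) (j ≟ c // δ)

  ∙≟-self : ∀ x δ → does (x ∙ δ ≟ x) ≡ does (δ ≟ ε)
  ∙≟-self x δ = does-⇔ (mk⇔ (identityʳ-unique x δ) (λ δ≡ε → trans (cong (x ∙_) δ≡ε) (identityʳ x)))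
                       (x ∙ δ ≟ x) (δ ≟ ε)

  //≟ε : ∀ c δ → does (c // δ ≟ ε) ≡ does (δ ≟ c)
  //≟ε c δ = does-⇔ (mk⇔ (sym ∘ x∙y⁻¹≈ε⇒x≈y c δ) (x≈y⇒x∙y⁻¹≈ε ∘ sym)) (c // δ ≟ ε) (δ ≟ c)

  count-≢ε-∧-translate-≡ : ∀ δ c →
    count (λ j → not (does (j ≟ ε)) ∧ does (j ∙ δ ≟ c)) ≡ indicator (not (does (δ ≟ c)))
  count-≢ε-∧-translate-≡ δ c = begin
    count (λ j → not (does (j ≟ ε)) ∧ does (j ∙ δ ≟ c))
      ≡⟨ count-cong (λ j → trans (cong (_ ∧_) (∙≟-translate j δ c)) (∧-comm (not (does (j ≟ ε))) _)) ⟩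
    count (λ j → does (j ≟ c // δ) ∧ not (does (j ≟ ε)))
      ≡⟨ count-singleton (c // δ) _ ⟩
    indicator (not (does (c // δ ≟ ε)))
      ≡⟨ cong (indicator ∘ not) (//≟ε c δ) ⟩
    indicator (not (does (δ ≟ c))) ∎

  count-≢ε-∧-translate-≢ε : ∀ δ → ¬ δ ≡ ε →
    2 + count (λ j → not (does (j ≟ ε)) ∧ not (does (j ∙ δ ≟ ε))) ≡ v
  count-≢ε-∧-translate-≢ε δ δ≢ε = begin
    2 + count (λ j → not (does (j ≟ ε)) ∧ not (does (j ∙ δ ≟ ε)))
      ≡⟨ cong (2 +_) (count-cong (λ j →
           cong (λ b → not (does (j ≟ ε)) ∧ not b) (∙≟-translate j δ ε))) ⟩
    1 + (1 + avoidingBoth)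
      ≡⟨ cong (λ k → 1 + (k + avoidingBoth))
           (trans (count-singleton ε _) (cong (indicator ∘ not) (dec-false (ε ≟ t) ε≢t))) ⟨
    1 + (count (λ j → does (j ≟ ε) ∧ not (does (j ≟ t))) + avoidingBoth)
      ≡⟨ cong (1 +_) (count-∧-split (λ j → does (j ≟ ε)) _) ⟩
    1 + count (λ j → not (does (j ≟ t)))
      ≡⟨ suc-count-≢ t ⟩
    v ∎
    where
    t : Fin v
    t = ε // δ
    ε≢t : ¬ ε ≡ t
    ε≢t ε≡t = δ≢ε (sym (x∙y⁻¹≈ε⇒x≈y ε δ (sym ε≡t)))
    avoidingBoth : ℕ
    avoidingBoth = count (λ j → not (does (j ≟ ε)) ∧ not (does (j ≟ t)))

-- Cayley digraphs of finite abelian groups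

module AbelianCayley {v} (G : FinAbelianGroup v) (S : Fin v → Bool) (S-ε : S (FinAbelianGroup.ε G) ≡ false) where

  open FinAbelianGroup G
    using ( _∙_; ε; _⁻¹; _\\_; x\\y≡ε⇔x≡y; x\\[y∙z]≡z∙[x\\y]; [x\\y]\\z≡x∙[y\\z]; [x\\y]\\y≡x
          ; finGroup; abelianGroup)
  open AbelianGroupProperties abelianGroup using (⁻¹-anti-homo-\\; \\-leftDividesʳ)
  open GroupCounting G using (count-∘-translate; count-∘-\\)

  D : Digraph v
  D = Cay finGroup S S-ε

  differenceCount : Fin v → ℕ
  differenceCount d = count (λ w → S w ∧ S (w ∙ d))

  outdeg-Cay : ∀ x → outdeg D x ≡ count S
  outdeg-Cay x = begin
    count (λ y → S (x \\ y))        ≡⟨ count-∘-translate x (λ y → S (x \\ y)) ⟨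
    count (λ w → S (x \\ (x ∙ w)))  ≡⟨ count-cong (λ w → cong S (\\-leftDividesʳ x w)) ⟩
    count S                         ∎

  indeg-Cay : ∀ x → indeg D x ≡ count S
  indeg-Cay x = count-∘-\\ x S

  commonOut-Cay : ∀ x y → commonOut D x y ≡ differenceCount (y \\ x)
  commonOut-Cay x y = begin
    count (λ z → S (x \\ z) ∧ S (y \\ z))
      ≡⟨ count-∘-translate x _ ⟨
    count (λ w → S (x \\ (x ∙ w)) ∧ S (y \\ (x ∙ w)))
      ≡⟨ count-cong (λ w → cong₂ (λ a b → S a ∧ S b) (\\-leftDividesʳ x w) (x\\[y∙z]≡z∙[x\\y] y x w)) ⟩
    differenceCount (y \\ x) ∎

  commonIn-Cay : ∀ x y → commonIn D x y ≡ differenceCount (x \\ y)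
  commonIn-Cay x y = begin
    count (λ z → S (z \\ x) ∧ S (z \\ y))
      ≡⟨ count-∘-\\ x _ ⟨
    count (λ w → S ((w \\ x) \\ x) ∧ S ((w \\ x) \\ y))
      ≡⟨ count-cong (λ w → cong₂ (λ a b → S a ∧ S b) ([x\\y]\\y≡x w x) ([x\\y]\\z≡x∙[y\\z] w x y)) ⟩
    differenceCount (x \\ y) ∎

  Cay-asymmetric : (∀ g → S g ≡ true → S (g ⁻¹) ≡ false) → IsAsymmetric D
  Cay-asymmetric S∩S⁻¹≡∅ x y Sxy = trans (cong S (sym (⁻¹-anti-homo-\\ x y))) (S∩S⁻¹≡∅ (x \\ y) Sxy)

  Cay-isDDD : ∀ {k λ₁ λ₂ m n} (cls : Fin v → Fin m) →
    count S ≡ k →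
    (∀ g → S g ≡ true → S (g ⁻¹) ≡ false) →
    IsPartition D m n cls →
    (∀ x y → cls x ≡ cls y ⇔ cls (x \\ y) ≡ cls ε) →
    (∀ d → ¬ d ≡ ε → cls d ≡ cls ε → differenceCount d ≡ λ₁) →
    (∀ d → ¬ cls d ≡ cls ε → differenceCount d ≡ λ₂) →
    IsDDD D k λ₁ λ₂ m n
  Cay-isDDD {k} {λ₁} {λ₂} cls |S|≡k S∩S⁻¹≡∅ partition sameClass⇔ inClass outOfClass =
      (λ x → trans (outdeg-Cay x) |S|≡k , trans (indeg-Cay x) |S|≡k)
    , Cay-asymmetric S∩S⁻¹≡∅
    , cls , partition
    , (λ x y x≢y clsx≡clsy →
          trans (commonIn-Cay x y) (sameClassCount x y x≢y clsx≡clsy)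
        , trans (commonOut-Cay x y) (sameClassCount y x (x≢y ∘ sym) (sym clsx≡clsy)))
    , (λ x y _ clsx≢clsy →
          trans (commonIn-Cay x y) (otherClassCount x y clsx≢clsy)
        , trans (commonOut-Cay x y) (otherClassCount y x (clsx≢clsy ∘ sym)))
    where
    sameClassCount : ∀ x y → ¬ x ≡ y → cls x ≡ cls y → differenceCount (x \\ y) ≡ λ₁
    sameClassCount x y x≢y clsx≡clsy =
      inClass (x \\ y) (x≢y ∘ Equivalence.to x\\y≡ε⇔x≡y) (Equivalence.to (sameClass⇔ x y) clsx≡clsy)

    otherClassCount : ∀ x y → ¬ cls x ≡ cls y → differenceCount (x \\ y) ≡ λ₂
    otherClassCount x y clsx≢clsy = outOfClass (x \\ y) (clsx≢clsy ∘ Equivalence.from (sameClass⇔ x y))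

-- The construction in ℤ₄ × ℤₙ, n = 3 + k

module Construction (k : ℕ) where

  n : ℕ
  n = 3 + k

  ℤ₄ : FinAbelianGroup 4
  ℤ₄ = cyclic 4

  ℤₙ : FinAbelianGroup n
  ℤₙ = cyclic n

  G : FinAbelianGroup (4 * n)
  G = ℤ₄ ×ᴳ ℤₙ

  module ℤ₄ = FinAbelianGroup ℤ₄
  module ℤₙ where
    open FinAbelianGroup ℤₙ public
    open AbelianGroupProperties abelianGroup public using (ε⁻¹≈ε; ⁻¹-injective)
  open FinAbelianGroup G using (_∙_; ε; _⁻¹; _\\_; finGroup)
  open Product ℤ₄ ℤₙ using (combine-∙; combine-⁻¹; quotient-∙; quotient-⁻¹)
  open GroupCounting ℤₙ using (∙≟-self; count-≢ε-∧-translate-≡; count-≢ε-∧-translate-≢ε)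

  1ₙ : Fin n
  1ₙ = suc zero

  row : Fin 4 → Fin n → Bool
  row 0F j = does (j ≟ 1ₙ)
  row 1F j = does (j ≟ zero)
  row 2F j = does (j ≟ 1ₙ)
  row 3F j = does (¬? (j ≟ zero))

  S : Fin (4 * n) → Bool
  S x = uncurry row (remQuot n x)

  S-combine : ∀ a j → S (combine a j) ≡ row a j
  S-combine a j = cong (uncurry row) (remQuot-combine a j)

  S-ε : S ε ≡ false
  S-ε = S-combine 0F zero

  |S| : count S ≡ n + 2
  |S| = begin
    count S
      ≡⟨ count-combine {4} {n} S ⟩
    ∑[ a < 4 ] count {n} (λ j → S (combine a j))
      ≡⟨ sum-cong-≗ (λ a → count-cong {n} (S-combine a)) ⟩
    ∑[ a < 4 ] count (row a)
      ≡⟨ sum-cong-≗ {4} {λ a → count (row a)} {1 ∷ 1 ∷ 1 ∷ 2 + k ∷ []}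
           (λ { 0F → count-≡ {n} 1ₙ ; 1F → count-≡ {n} zero ; 2F → count-≡ {n} 1ₙ
              ; 3F → suc-injective (suc-count-≢ {n} zero) }) ⟩
    sum (1 ∷ 1 ∷ 1 ∷ 2 + k ∷ [])
      ≡⟨ cong (3 +_) (trans (+-identityʳ (2 + k)) (+-comm 2 k)) ⟩
    n + 2 ∎

  toℕ-[-1ₙ] : toℕ (1ₙ ℤₙ.⁻¹) ≡ 2 + k
  toℕ-[-1ₙ] = trans (Cyclic.toℕ-mod n (2 + k)) (m<n⇒m%n≡m (n<1+n (2 + k)))

  -1ₙ≢1ₙ : ¬ 1ₙ ℤₙ.⁻¹ ≡ 1ₙ
  -1ₙ≢1ₙ -1≡1 with () ← trans (sym toℕ-[-1ₙ]) (cong toℕ -1≡1)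

  row-asymmetric : ∀ a δ → row a δ ≡ true → row (a ℤ₄.⁻¹) (δ ℤₙ.⁻¹) ≡ false
  row-asymmetric 0F δ δ≡1 with refl ← does-true (δ ≟ 1ₙ) δ≡1 = dec-false (_ ≟ 1ₙ) -1ₙ≢1ₙ
  row-asymmetric 1F δ δ≡0 with refl ← does-true (δ ≟ zero) δ≡0 = cong not (dec-true (_ ≟ zero) ℤₙ.ε⁻¹≈ε)
  row-asymmetric 2F δ δ≡1 with refl ← does-true (δ ≟ 1ₙ) δ≡1 = dec-false (_ ≟ 1ₙ) -1ₙ≢1ₙ
  row-asymmetric 3F δ δ≢0 = dec-false (_ ≟ zero) λ -δ≡0 →
    does-true (¬? (δ ≟ zero)) δ≢0 (ℤₙ.⁻¹-injective (trans -δ≡0 (sym ℤₙ.ε⁻¹≈ε)))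

  S∩S⁻¹≡∅ : ∀ g → S g ≡ true → S (g ⁻¹) ≡ false
  S∩S⁻¹≡∅ = ∀-combine λ a δ Sg → begin
    S (combine a δ ⁻¹)               ≡⟨ cong S (combine-⁻¹ a δ) ⟩
    S (combine (a ℤ₄.⁻¹) (δ ℤₙ.⁻¹))  ≡⟨ S-combine (a ℤ₄.⁻¹) (δ ℤₙ.⁻¹) ⟩
    row (a ℤ₄.⁻¹) (δ ℤₙ.⁻¹)          ≡⟨ row-asymmetric a δ (trans (sym (S-combine a δ)) Sg) ⟩
    false                            ∎

  open AbelianCayley G S S-ε using (D; differenceCount; Cay-isDDD)

  rowDifferenceCount : Fin 4 → Fin n → Fin 4 → ℕ
  rowDifferenceCount a δ i = count (λ j → row i j ∧ row (i ℤ₄.∙ a) (j ℤₙ.∙ δ))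

  differenceCount-by-rows : ∀ a δ (g : Fin 4 → ℕ) → (∀ i → rowDifferenceCount a δ i ≡ g i) →
                            differenceCount (combine a δ) ≡ sum g
  differenceCount-by-rows a δ g rows≡g = begin
    differenceCount (combine a δ)
      ≡⟨ count-combine {4} {n} (λ w → S w ∧ S (w ∙ combine a δ)) ⟩
    ∑[ i < 4 ] count {n} (λ j → S (combine i j) ∧ S (combine i j ∙ combine a δ))
      ≡⟨ sum-cong-≗ (λ i → count-cong {n} (λ j → cong₂ _∧_ (S-combine i j)
           (trans (cong S (combine-∙ i j a δ)) (S-combine (i ℤ₄.∙ a) (j ℤₙ.∙ δ))))) ⟩
    ∑[ i < 4 ] rowDifferenceCount a δ i
      ≡⟨ sum-cong-≗ {4} {rowDifferenceCount a δ} {g} rows≡g ⟩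
    sum g ∎

  rowDifferenceCount-0F : ∀ a δ → rowDifferenceCount a δ 0F ≡ indicator (row (0F ℤ₄.∙ a) (1ₙ ℤₙ.∙ δ))
  rowDifferenceCount-0F a δ = count-singleton 1ₙ (λ j → row (0F ℤ₄.∙ a) (j ℤₙ.∙ δ))

  rowDifferenceCount-1F : ∀ a δ → rowDifferenceCount a δ 1F ≡ indicator (row (1F ℤ₄.∙ a) (zero ℤₙ.∙ δ))
  rowDifferenceCount-1F a δ = count-singleton zero (λ j → row (1F ℤ₄.∙ a) (j ℤₙ.∙ δ))

  rowDifferenceCount-2F : ∀ a δ → rowDifferenceCount a δ 2F ≡ indicator (row (2F ℤ₄.∙ a) (1ₙ ℤₙ.∙ δ))
  rowDifferenceCount-2F a δ = count-singleton 1ₙ (λ j → row (2F ℤ₄.∙ a) (j ℤₙ.∙ δ))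

  0ₙ∙δ≟ : ∀ δ c → does (zero ℤₙ.∙ δ ≟ c) ≡ does (δ ≟ c)
  0ₙ∙δ≟ δ c = cong (λ x → does (x ≟ c)) (ℤₙ.identityˡ δ)

  differenceCount-combine-0F : ∀ (δ : Fin n) → ¬ δ ≡ zero → differenceCount (combine {4} 0F δ) ≡ suc k
  differenceCount-combine-0F δ δ≢0 = trans (differenceCount-by-rows 0F δ (0 ∷ 0 ∷ 0 ∷ suc k ∷ []) λ
    { 0F → trans (rowDifferenceCount-0F 0F δ) (cong indicator (trans (∙≟-self 1ₙ δ) δ≟0))
    ; 1F → trans (rowDifferenceCount-1F 0F δ) (cong indicator (trans (0ₙ∙δ≟ δ zero) δ≟0))
    ; 2F → trans (rowDifferenceCount-2F 0F δ) (cong indicator (trans (∙≟-self 1ₙ δ) δ≟0))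
    ; 3F → suc-injective (suc-injective (count-≢ε-∧-translate-≢ε δ δ≢0)) })
    (+-identityʳ (suc k))
    where
    δ≟0 : does (δ ≟ zero) ≡ false
    δ≟0 = dec-false (δ ≟ zero) δ≢0

  differenceCount-combine-≢0F : ∀ (a : Fin 4) (δ : Fin n) → ¬ a ≡ 0F → differenceCount (combine {4} a δ) ≡ 2
  differenceCount-combine-≢0F 0F δ a≢0 = contradiction refl a≢0
  differenceCount-combine-≢0F 1F δ _ = trans
    (differenceCount-by-rows 1F δ
       (indicator u ∷ indicator o ∷ indicator (not u) ∷ indicator (not o) ∷ []) λ
      { 0F → rowDifferenceCount-0F 1F δ
      ; 1F → trans (rowDifferenceCount-1F 1F δ) (cong indicator (0ₙ∙δ≟ δ 1ₙ))
      ; 2F → rowDifferenceCount-2F 1F δ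
      ; 3F → count-≢ε-∧-translate-≡ δ 1ₙ })
    (indicator-interleaved-complements u o)
    where
    u = does (1ₙ ℤₙ.∙ δ ≟ zero)
    o = does (δ ≟ 1ₙ)
  differenceCount-combine-≢0F 2F δ _ = trans
    (differenceCount-by-rows 2F δ
       (indicator z ∷ indicator (not z) ∷ indicator z ∷ indicator (not z) ∷ []) λ
      { 0F → trans (rowDifferenceCount-0F 2F δ) (cong indicator (∙≟-self 1ₙ δ))
      ; 1F → trans (rowDifferenceCount-1F 2F δ) (cong (indicator ∘ not) (0ₙ∙δ≟ δ zero))
      ; 2F → trans (rowDifferenceCount-2F 2F δ) (cong indicator (∙≟-self 1ₙ δ))
      ; 3F → count-≢ε-∧-translate-≡ δ zero })
    (indicator-adjacent-complements z)
    where
    z = does (δ ≟ zero)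
  differenceCount-combine-≢0F 3F δ _ = trans
    (differenceCount-by-rows 3F δ
       (indicator (not u) ∷ indicator o ∷ indicator (not (not u)) ∷ indicator (not o) ∷ []) λ
      { 0F → rowDifferenceCount-0F 3F δ
      ; 1F → trans (rowDifferenceCount-1F 3F δ) (cong indicator (0ₙ∙δ≟ δ 1ₙ))
      ; 2F → trans (rowDifferenceCount-2F 3F δ) (cong indicator (sym (not-involutive u)))
      ; 3F → count-≢ε-∧-translate-≡ δ 1ₙ })
    (indicator-interleaved-complements (not u) o)
    where
    u = does (1ₙ ℤₙ.∙ δ ≟ zero)
    o = does (δ ≟ 1ₙ)

  cls : Fin (4 * n) → Fin 4
  cls = quotient n

  cls-combine : ∀ (a : Fin 4) (j : Fin n) → cls (combine a j) ≡ a
  cls-combine a j = cong proj₁ (remQuot-combine a j)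

  cls-\\ : ∀ x y → cls (x \\ y) ≡ cls x ℤ₄.\\ cls y
  cls-\\ x y = trans (quotient-∙ (x ⁻¹) y) (cong (ℤ₄._∙ cls y) (quotient-⁻¹ x))

  sameClass⇔ : ∀ x y → cls x ≡ cls y ⇔ cls (x \\ y) ≡ cls ε
  sameClass⇔ x y = mk⇔
    (λ clsx≡clsy → trans (cls-\\ x y) (Equivalence.from ℤ₄.x\\y≡ε⇔x≡y clsx≡clsy))
    (λ cls[x\\y]≡0 → Equivalence.to ℤ₄.x\\y≡ε⇔x≡y (trans (sym (cls-\\ x y)) cls[x\\y]≡0))

  partition : IsPartition D 4 n cls
  partition i = begin
    count (λ x → ⌊ cls x ≟ i ⌋)     ≡⟨ count-cong (λ x → isYes≗does (cls x ≟ i)) ⟩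
    count (λ x → does (cls x ≟ i))  ≡⟨ count-quotient n (λ a → does (a ≟ i)) ⟩
    count (λ a → does (a ≟ i)) * n  ≡⟨ cong (_* n) (count-≡ i) ⟩
    1 * n                           ≡⟨ *-identityˡ n ⟩
    n                               ∎

  differenceCount-sameClass : ∀ d → ¬ d ≡ ε → cls d ≡ cls ε → differenceCount d ≡ n ∸ 2
  differenceCount-sameClass = ∀-combine sameClass
    where
    sameClass : ∀ (a : Fin 4) (δ : Fin n) → ¬ combine a δ ≡ ε → cls (combine a δ) ≡ 0F →
                differenceCount (combine a δ) ≡ suc k
    sameClass a δ d≢ε cls≡0 with refl ← trans (sym (cls-combine a δ)) cls≡0 =
      differenceCount-combine-0F δ (d≢ε ∘ cong (combine {4} 0F))

  differenceCount-otherClass : ∀ d → ¬ cls d ≡ cls ε → differenceCount d ≡ 2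
  differenceCount-otherClass = ∀-combine {4} λ a δ cls≢0 →
    differenceCount-combine-≢0F a δ (cls≢0 ∘ trans (cls-combine a δ))

  isDDCayley : ExistsDDCayley (4 * n) (n + 2) (n ∸ 2) 2 4 n
  isDDCayley = finGroup , S , S-ε ,
    Cay-isDDD cls |S| S∩S⁻¹≡∅ partition sameClass⇔ differenceCount-sameClass differenceCount-otherClass

mainTheorem12 : ∀ (n : ℕ) → Σ ℕ (λ t → n ≡ suc (2 * t)) → 3 ≤ n →
    ExistsDDCayley (4 * n) (n + 2) (n ∸ 2) 2 4 n
mainTheorem12 (suc (suc (suc k))) _ _ = Construction.isDDCayley k
mainTheorem12 (suc zero)          _ (s≤s ())
mainTheorem12 (suc (suc zero))    _ (s≤s (s≤s ()))
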